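{- Let $G$ and $H$ be graphs, with $V(G)=\{w_1,\dots,w_g\}$ and $V(H)=\{v_1,\dots,v_h\}$, and let $D$ be a distribution of pebbles on $G\square H$. Let $\tilde D$ be the associated $g$-colored distribution on $\tilde H$. If $\tilde D$ is $\gamma(G)$-coverable, then $D$ is coverable (i.e., $G\square H$ can be cover pebbled starting from $D$).
   Context: All graphs are finite and connected. A distribution of pebbles on a graph is an assignment of a nonnegative number of pebbles to each vertex. A pebbling step removes two pebbles from a vertex and places one pebble on an adjacent vertex. A distribution is coverable if some sequence of pebbling steps results in every vertex having at least one pebble. The cover pebbling number $\gamma(G)$ is the minimum number $N$ such that every distribution of $N$ pebbles on $G$ is coverable. The product $G\square H$ has vertex set $V(G)\times V(H)$, with $(w,v)$ adjacent to $(w',v')$ iff either $w=w'$ and $vv'\in E(H)$, or $v=v'$ and $ww'\in E(G)$. A $t$-colored distribution is a distribution in which each pebble is assigned one of $t$ colors; a color-respecting pebbling step removes two pebbles of the same color from a vertex and places one pebble of that color on an adjacent vertex; only color-respecting steps are allowed for colored distributions. A colored distribution on a graph is $Q$-coverable if some sequence of color-respecting steps results in every vertex having at least $Q$ pebbles (of any colors). Given a distribution $D$ on $G\square H$, the associated $g$-colored distribution $\tilde D$ on $\tilde H$ (a copy of $H$ with vertices $V_1,\dots,V_h$ corresponding to $v_1,\dots,v_h$) is obtained by giving color $c_i$ to every pebble that $D$ places on a vertex $(w_i,v_j)$ and placing all pebbles of $G\square\{v_j\}$ on $V_j$. -}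

module Defs where

open import Data.Nat using (ℕ; zero; suc; _+_; _∸_; _≤_)
open import Data.Fin using (Fin; zero; suc)
import Data.Fin.Properties as FinP
open import Data.Product using (Σ; ∃; _×_; _,_)
import Data.Product.Properties as ProdP
open import Data.Sum using (_⊎_)
open import Data.Bool using (if_then_else_)
open import Relation.Nullary using (¬_; does)
open import Relation.Binary.PropositionalEquality using (_≡_)
open import Relation.Binary.Definitions using (DecidableEquality)
open import Relation.Binary.Construct.Closure.ReflexiveTransitive using (Star)

sumFin : ∀ {n} → (Fin n → ℕ) → ℕ
sumFin {zero} f = 0
sumFin {suc n} f = f zero + sumFin (λ i → f (suc i))

record Graph : Set₁ where
  field
    n         : ℕ
    Adj       : Fin n → Fin n → Set
    sym       : ∀ {u v} → Adj u v → Adj v u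
    irrefl    : ∀ {u} → ¬ Adj u u
    connected : ∀ u v → Star Adj u v
open Graph public

ProdAdj : (G H : Graph) → Fin (n G) × Fin (n H) → Fin (n G) × Fin (n H) → Set
ProdAdj G H (w , v) (w' , v') = (w ≡ w' × Adj H v v') ⊎ (v ≡ v' × Adj G w w')

prodDecEq : (G H : Graph) → DecidableEquality (Fin (n G) × Fin (n H))
prodDecEq G H = ProdP.≡-dec FinP._≟_ FinP._≟_

Dist : Set → Set
Dist V = V → ℕ

ind : ∀ {V : Set} → DecidableEquality V → V → V → ℕ
ind _≟_ x u = if does (x ≟ u) then 1 else 0

move : ∀ {V : Set} → DecidableEquality V → V → V → Dist V → Dist V
move _≟_ u v D x = (D x ∸ (ind _≟_ x u + ind _≟_ x u)) + ind _≟_ x v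

data Step {V : Set} (_≟_ : DecidableEquality V) (Adj : V → V → Set) : Dist V → Dist V → Set where
  step : ∀ {D} (u v : V) → Adj u v → 2 ≤ D u → Step _≟_ Adj D (move _≟_ u v D)

Coverable : ∀ {V : Set} → DecidableEquality V → (V → V → Set) → Dist V → Set
Coverable _≟_ Adj D = ∃ λ D' → Star (Step _≟_ Adj) D D' × (∀ x → 1 ≤ D' x)

GCoverable : (G : Graph) → Dist (Fin (n G)) → Set
GCoverable G = Coverable FinP._≟_ (Adj G)

ProdCoverable : (G H : Graph) → Dist (Fin (n G) × Fin (n H)) → Set
ProdCoverable G H = Coverable (prodDecEq G H) (ProdAdj G H)

AllCoverable : Graph → ℕ → Set
AllCoverable G N = (D : Dist (Fin (n G))) → sumFin D ≡ N → GCoverable G D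

IsCoverPebblingNumber : Graph → ℕ → Set
IsCoverPebblingNumber G N = AllCoverable G N × (∀ M → AllCoverable G M → N ≤ M)

CDist : ℕ → ℕ → Set
CDist h t = Fin h → Fin t → ℕ

cmove : ∀ {h t} → Fin h → Fin h → Fin t → CDist h t → CDist h t
cmove u v c C x d =
  if does (d FinP.≟ c) then move FinP._≟_ u v (λ y → C y c) x else C x d

data CStep (H : Graph) (t : ℕ) : CDist (n H) t → CDist (n H) t → Set where
  cstep : ∀ {C} (u v : Fin (n H)) (c : Fin t) → Adj H u v → 2 ≤ C u c →
          CStep H t C (cmove u v c C)

QCoverable : (H : Graph) (t : ℕ) → ℕ → CDist (n H) t → Set
QCoverable H t Q C =
  ∃ λ C' → Star (CStep H t) C C' × (∀ x → Q ≤ sumFin (C' x))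

-- associated g-colored distribution on H̃: vertex V_j gets D(w_i, v_j) pebbles of color c_i
assoc : (G H : Graph) → Dist (Fin (n G) × Fin (n H)) → CDist (n H) (n G)
assoc G H D j i = D (i , j)

-- A pebble of colour c moving on H̃ is mirrored by the same move inside the copy {w_c} × H of H,
-- and pebbling is monotone, so the product distribution keeps dominating the colour classes
-- of the coloured one.  Once every V_j carries γ(G) pebbles, the fibre G × {v_j} carries
-- γ(G) pebbles, and a cover solution of G run inside that fibre only spends pebbles of that
-- fibre; so the fibres can be covered one after another.
module Submission where

open import Defs hiding (sym)
open import Data.Nat using (ℕ; zero; suc; _+_; _⊓_; _≤_; z≤n)
open import Data.Nat.Properties
  using (≤-refl; ≤-trans; +-mono-≤; +-monoˡ-≤; ∸-monoˡ-≤; m≤m+n; m⊓n≤m; m⊓n+n∸m≡n; m≤n+o⇒m∸n≤o)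
open import Data.Fin using (Fin; zero; suc)
import Data.Fin.Properties as FinP
open import Data.Product using (_×_; _,_; ∃; proj₁; proj₂)
open import Data.Sum using (inj₁; inj₂)
open import Data.List using (_∷_)
open import Data.List.Relation.Unary.Any using (here; there)
open import Data.List.Relation.Unary.All using () renaming (lookup to All-lookup)
open import Data.List.Relation.Unary.All.Properties using (All¬⇒¬Any)
open import Data.List.Relation.Unary.Unique.Propositional using (Unique; []; _∷_)
open import Data.List.Relation.Unary.Unique.Propositional.Properties using (allFin⁺)
open import Data.List.Membership.Propositional using (_∈_; _∉_)
open import Data.List.Membership.Propositional.Properties using (∈-allFin)
open import Function using (_∘_)
open import Function.Definitions using (Injective)
open import Relation.Nullary using (yes; no)
open import Relation.Nullary.Decidable using (dec-true; dec-false)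
open import Relation.Binary.PropositionalEquality using (_≡_; _≢_; refl; sym; trans; cong)
open import Relation.Binary.Definitions using (DecidableEquality)
open import Relation.Binary.Construct.Closure.ReflexiveTransitive using (Star; ε; _◅_; _◅◅_)

sumFin-mono : ∀ {m} {f g : Fin m → ℕ} → (∀ i → f i ≤ g i) → sumFin f ≤ sumFin g
sumFin-mono {zero}  f≤g = z≤n
sumFin-mono {suc m} f≤g = +-mono-≤ (f≤g zero) (sumFin-mono (f≤g ∘ suc))

sumFin-shrink : ∀ {m} (E : Fin m → ℕ) {k} → k ≤ sumFin E →
  ∃ λ E₀ → (∀ i → E₀ i ≤ E i) × sumFin E₀ ≡ k
sumFin-shrink {zero}  E z≤n = (λ ()) , (λ ()) , refl
sumFin-shrink {suc m} E {k} k≤ΣE =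
  let E₀ , E₀≤E , ΣE₀≡ = sumFin-shrink (E ∘ suc) (m≤n+o⇒m∸n≤o k (E zero) k≤ΣE)
  in  (λ { zero → E zero ⊓ k ; (suc i) → E₀ i })
    , (λ { zero → m⊓n≤m (E zero) k ; (suc i) → E₀≤E i })
    , trans (cong (E zero ⊓ k +_) ΣE₀≡) (m⊓n+n∸m≡n (E zero) k)

module _ {V : Set} (_≟_ : DecidableEquality V) where

  ind-≡ : ∀ {x u} → x ≡ u → ind _≟_ x u ≡ 1
  ind-≡ {x} {u} x≡u rewrite dec-true (x ≟ u) x≡u = refl

  ind-≢ : ∀ {x u} → x ≢ u → ind _≟_ x u ≡ 0
  ind-≢ {x} {u} x≢u rewrite dec-false (x ≟ u) x≢u = refl

  move-off-source : ∀ (P : Dist V) {u v y} → y ≢ u → P y ≤ move _≟_ u v P y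
  move-off-source P {v = v} {y} y≢u rewrite ind-≢ y≢u = m≤m+n (P y) (ind _≟_ y v)

-- Off the image of f no vertex loses pebbles, since every replayed move starts inside it.
module _ {V W : Set} (_≟V_ : DecidableEquality V) (_≟W_ : DecidableEquality W)
         {AdjV : V → V → Set} {AdjW : W → W → Set}
         (f : V → W) (f-injective : Injective _≡_ _≡_ f)
         (f-adj : ∀ {u v} → AdjV u v → AdjW (f u) (f v)) where

  ind-injective : ∀ x u → ind _≟W_ (f x) (f u) ≡ ind _≟V_ x u
  ind-injective x u with x ≟V u
  ... | yes x≡u = ind-≡ _≟W_ (cong f x≡u)
  ... | no  x≢u = ind-≢ _≟W_ (x≢u ∘ f-injective)

  move-lift : ∀ {D : Dist V} {P : Dist W} → (∀ x → D x ≤ P (f x)) →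
    ∀ u v x → move _≟V_ u v D x ≤ move _≟W_ (f u) (f v) P (f x)
  move-lift D≤P u v x rewrite ind-injective x u | ind-injective x v =
    +-monoˡ-≤ (ind _≟V_ x v) (∸-monoˡ-≤ (ind _≟V_ x u + ind _≟V_ x u) (D≤P x))

  lift-steps : ∀ {D D'} → Star (Step _≟V_ AdjV) D D' → ∀ P → (∀ x → D x ≤ P (f x)) →
    ∃ λ P' → Star (Step _≟W_ AdjW) P P' × (∀ x → D' x ≤ P' (f x))
           × (∀ y → (∀ x → y ≢ f x) → P y ≤ P' y)
  lift-steps ε P D≤P = P , ε , D≤P , λ _ _ → ≤-refl
  lift-steps (step u v adj two≤Du ◅ rest) P D≤P =
    let P' , steps , D'≤P' , P₁≤P' = lift-steps rest (move _≟W_ (f u) (f v) P) (move-lift {P = P} D≤P u v)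
    in  P' , step (f u) (f v) (f-adj adj) (≤-trans two≤Du (D≤P u)) ◅ steps , D'≤P'
      , λ y y∉f → ≤-trans (move-off-source _≟W_ P (y∉f u)) (P₁≤P' y y∉f)

module _ (G H : Graph) where

  Vert : Set
  Vert = Fin (n G) × Fin (n H)

  ProdStep : Dist Vert → Dist Vert → Set
  ProdStep = Step (prodDecEq G H) (ProdAdj G H)

  fibre : Dist Vert → Fin (n H) → Dist (Fin (n G))
  fibre P j i = P (i , j)

  Dominates : CDist (n H) (n G) → Dist Vert → Set
  Dominates C P = ∀ i j → C j i ≤ P (i , j)

  cmove-dominated : ∀ {C P'} u v c →
    (∀ j → move FinP._≟_ u v (λ y → C y c) j ≤ P' (c , j)) →
    (∀ i j → i ≢ c → C j i ≤ P' (i , j)) →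
    Dominates (cmove u v c C) P'
  cmove-dominated u v c moved≤P' rest≤P' i j with i FinP.≟ c
  ... | yes refl = moved≤P' j
  ... | no  i≢c  = rest≤P' i j i≢c

  lift-colored-step : ∀ {C C'} → CStep H (n G) C C' → ∀ P → Dominates C P →
    ∃ λ P' → Star ProdStep P P' × Dominates C' P'
  lift-colored-step (cstep {C} u v c adj two≤Cuc) P C≤P =
    let P' , steps , moved≤P' , P≤P' =
          lift-steps FinP._≟_ (prodDecEq G H) (c ,_) (cong proj₂) (λ adj → inj₁ (refl , adj))
                     (step u v adj two≤Cuc ◅ ε) P (C≤P c)
    in  P' , steps , cmove-dominated u v c moved≤P'
          (λ i j i≢c → ≤-trans (C≤P i j) (P≤P' (i , j) λ _ eq → i≢c (cong proj₁ eq)))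

  lift-colored-steps : ∀ {C C'} → Star (CStep H (n G)) C C' → ∀ P → Dominates C P →
    ∃ λ P' → Star ProdStep P P' × Dominates C' P'
  lift-colored-steps ε P C≤P = P , ε , C≤P
  lift-colored-steps (cs ◅ rest) P C≤P =
    let P₁ , steps₁ , C₁≤P₁ = lift-colored-step cs P C≤P
        P₂ , steps₂ , C'≤P₂ = lift-colored-steps rest P₁ C₁≤P₁
    in  P₂ , steps₁ ◅◅ steps₂ , C'≤P₂

  module _ {γ : ℕ} (γ-suffices : AllCoverable G γ) where

    cover-fibre : ∀ P j → γ ≤ sumFin (fibre P j) →
      ∃ λ P' → Star ProdStep P P' × (∀ i → 1 ≤ P' (i , j))
             × (∀ i j' → j' ≢ j → P (i , j') ≤ P' (i , j'))
    cover-fibre P j γ≤ =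
      let E , E≤P , ΣE≡γ = sumFin-shrink (fibre P j) γ≤
          F , E→F , F-covered = γ-suffices E ΣE≡γ
          P' , steps , F≤P' , P≤P' =
            lift-steps FinP._≟_ (prodDecEq G H) (_, j) (cong proj₁) (λ adj → inj₂ (refl , adj))
                       E→F P E≤P
      in  P' , steps , (λ i → ≤-trans (F-covered i) (F≤P' i))
        , λ i j' j'≢j → P≤P' (i , j') λ _ eq → j'≢j (cong proj₂ eq)

    cover-fibres : ∀ {L} → Unique L → ∀ P → (∀ j → j ∈ L → γ ≤ sumFin (fibre P j)) →
      ∃ λ P' → Star ProdStep P P' × (∀ j → j ∈ L → ∀ i → 1 ≤ P' (i , j))
             × (∀ i j → j ∉ L → P (i , j) ≤ P' (i , j))
    cover-fibres [] P _ = P , ε , (λ _ ()) , λ _ _ _ → ≤-refl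
    cover-fibres {j ∷ L} (j∉L ∷ unique) P enough =
      let P₁ , steps₁ , covered₁ , P≤P₁ = cover-fibres unique P (λ j' → enough j' ∘ there)
          P₂ , steps₂ , covered₂ , P₁≤P₂ =
            cover-fibre P₁ j (≤-trans (enough j (here refl))
                                      (sumFin-mono λ i → P≤P₁ i j (All¬⇒¬Any j∉L)))
      in  P₂ , steps₁ ◅◅ steps₂
        , (λ { j' (here refl) → covered₂
             ; j' (there j'∈L) i → ≤-trans (covered₁ j' j'∈L i)
                                           (P₁≤P₂ i j' (All-lookup j∉L j'∈L ∘ sym)) })
        , λ i j' j'∉ → ≤-trans (P≤P₁ i j' (j'∉ ∘ there)) (P₁≤P₂ i j' (j'∉ ∘ here))

    cover-from-colored : ∀ {D} → QCoverable H (n G) γ (assoc G H D) → ProdCoverable G H D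
    cover-from-colored {D} (C , colored-steps , C-covered) =
      let D₁ , steps₁ , C≤D₁ = lift-colored-steps colored-steps D (λ _ _ → ≤-refl)
          D₂ , steps₂ , covered , _ =
            cover-fibres (allFin⁺ (n H)) D₁
              (λ j _ → ≤-trans (C-covered j) (sumFin-mono λ i → C≤D₁ i j))
      in  D₂ , steps₁ ◅◅ steps₂ , λ (i , j) → covered j (∈-allFin j) i

lemma2p1 : (G H : Graph) (D : Dist (Fin (n G) × Fin (n H))) (γG : ℕ) →
    IsCoverPebblingNumber G γG →
    QCoverable H (n G) γG (assoc G H D) →
    ProdCoverable G H D
lemma2p1 G H D γG (γG-suffices , _) = cover-from-colored G H γG-suffices
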